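{- Let $(s_p,s_q)$ be an implementation of a two-process architecture and $\varphi_p$ a local specification for $p$ whose time-bounded distinguishability relation $\Lambda_p$ is uniform. Suppose every trace $\pi\in\mathit{Traces}(s_p,s_q)$ satisfies $\pi{\downarrow_{O_e\cup O_p}}\models\varphi_p$. Then $(s_p,s_q)$ satisfies the time-bounded information flow assumption $\chi_p$, i.e. there exists a function $t:(2^{O_e})^\omega\to\mathbb N$ such that for all $\pi,\pi'\in\mathit{Traces}(s_p,s_q)$ with $(\pi{\downarrow_{O_e}},\pi'{\downarrow_{O_e}})\in\Lambda_p$ we have $\pi[0..t(\pi{\downarrow_{O_e}})]{\downarrow_{I_p}}\neq\pi'[0..t(\pi{\downarrow_{O_e}})]{\downarrow_{I_p}}$.
   Context: Let $\mathcal V$ be a finite set of boolean variables. A two-process architecture is given by sets $O_p,O_q,O_e\subseteq\mathcal V$ forming a partition of $\mathcal V$ (outputs of process $p$, process $q$, environment), with input sets $I_p\subseteq O_q\cup O_e$, $I_q\subseteq O_p\cup O_e$. Valuations of $V$ are subsets of $V$; traces over $V$ are elements of $(2^V)^\omega$; $\sqcup$ is positionwise union of traces over disjoint sets and ${\downarrow_{V'}}$ is positionwise intersection with $V'$. For a trace $\pi$, $\pi[0..n]$ is its finite prefix of positions $0,\ldots,n$. A strategy for $p$ is $s_p:(2^{I_p})^*\to 2^{O_p}$, similarly $s_q:(2^{I_q})^*\to 2^{O_q}$. Their composition $s:(2^{O_e})^*\to 2^{\mathcal V}$: $s(\epsilon)=s_p(\epsilon)\cup s_q(\epsilon)$, $s(v\cdot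 x)=s_p(f_p(v))\cup s_q(f_q(v))\cup x$, where $f_p(\epsilon)=f_q(\epsilon)=\epsilon$, $f_p(v\cdot x)=f_p(v)\cdot((x\cup s_q(f_q(v)))\cap I_p)$, $f_q(v\cdot x)=f_q(v)\cdot((x\cup s_p(f_p(v)))\cap I_q)$. $\mathit{Traces}(s_p,s_q)$ is the set of $x_0x_1\ldots\in(2^{\mathcal V})^\omega$ such that for some $i_0i_1\ldots\in(2^{O_e})^\omega$, $x_k=s(i_0\ldots i_{k-1})$ for all $k$. A local specification $\varphi_p$ is an LTL formula over $O_p\cup O_e$. A trace $\pi$ finitely violates $\varphi$, written $\pi\not\models_f\varphi$, if some finite prefix $w$ of $\pi$ is such that every infinite trace extending $w$ violates $\varphi$; $\pi\not\models_n\varphi$ means that the prefix of $\pi$ of length $n$ already has this property (every infinite extension of it violates $\varphi$). The time-bounded distinguishability relation is $\Lambda_p=\{(\pi_e,\pi_e')\in(2^{O_e})^\omega\times(2^{O_e})^\omega\mid\forall\pi_p\in(2^{O_p})^\omega:\ \text{if }\pi_e\sqcup\pi_p\models\varphi_p\text{ then }\pi_e'\sqcup\pi_p\not\models_f\varphi_p\}$. $\Lambda_p$ is uniform if for every $\pi_e\in(2^{O_e})^\omega$ and $\pi_p\in(2^{O_p})^\omega$ there is $n\in\mathbb N$ such that for all $\pi_e'$ with $(\pi_e,\pi_e')\in\Lambda_p$: if $\pi_e\sqcup\pi_p\models\varphi_p$ then $\pi_e'\sqcup\pi_p\not\models_n\varphi_p$. The time-bounded information flow assumption $\chi_p$ is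 the union, over all $t:(2^{O_e})^\omega\to\mathbb N$, of the 2-hyperproperties induced by $R_t=\{(\pi,\pi')\mid \text{if }(\pi{\downarrow_{O_e}},\pi'{\downarrow_{O_e}})\in\Lambda_p\text{ then }\pi[0..t(\pi{\downarrow_{O_e}})]{\downarrow_{I_p}}\neq\pi'[0..t(\pi{\downarrow_{O_e}})]{\downarrow_{I_p}}\}$; a set of traces $T$ satisfies the 2-hyperproperty induced by $R_t$ iff $(\pi,\pi')\in R_t$ for all $\pi,\pi'\in T$. -}

module Defs where

open import Data.Nat using (ℕ; zero; suc; _<_; _≤_)
open import Data.Fin using (Fin)
open import Data.Fin.Subset using (Subset; _∈_; _⊆_; _∩_; _∪_; ⊥; ⊤)
open import Data.List using (List; []; _∷_; reverse)
open import Data.Product using (Σ; _×_)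
open import Relation.Binary.PropositionalEquality using (_≡_)
open import Relation.Nullary using (¬_)
open import Data.Unit using () renaming (⊤ to Unit)

-- The variable set 𝒱 is Fin N.  A valuation of V ⊆ 𝒱 is a subset of 𝒱
-- (an element of Subset N) contained in V.  A trace is ℕ → Subset N.
Trace : ℕ → Set
Trace N = ℕ → Subset N

TraceOver : {N : ℕ} → Subset N → Trace N → Set
TraceOver V π = ∀ k → π k ⊆ V

_⊔_ : {N : ℕ} → Trace N → Trace N → Trace N
(π ⊔ ρ) k = π k ∪ ρ k

_↓_ : {N : ℕ} → Trace N → Subset N → Trace N
(π ↓ V) k = π k ∩ V

record Arch (N : ℕ) : Set where
  field
    Op Oq Oe Ip Iq : Subset N
    pq-disj : Op ∩ Oq ≡ ⊥
    pe-disj : Op ∩ Oe ≡ ⊥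
    qe-disj : Oq ∩ Oe ≡ ⊥
    cover   : (Op ∪ Oq) ∪ Oe ≡ ⊤
    Ip-sub  : Ip ⊆ (Oq ∪ Oe)
    Iq-sub  : Iq ⊆ (Op ∪ Oe)

-- Strategies: functions from finite (chronological) input sequences to valuations.
-- In the composition the inputs passed to s_p are always valuations of I_p and
-- the output of s_p is intersected with O_p (similarly for q), so every such
-- function represents exactly one strategy (2^{I_p})^* → 2^{O_p}, and every
-- strategy arises this way.
Strategy : ℕ → Set
Strategy N = List (Subset N) → Subset N

module Composition {N : ℕ} (A : Arch N) (sp sq : Strategy N) where
  open Arch A

  -- sequences below are stored in REVERSED order (most recent element first)
  sp' : List (Subset N) → Subset N
  sp' w = sp (reverse w) ∩ Op

  sq' : List (Subset N) → Subset N
  sq' w = sq (reverse w) ∩ Oq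

  mutual
    fp : List (Subset N) → List (Subset N)
    fp [] = []
    fp (x ∷ v) = ((x ∪ sq' (fq v)) ∩ Ip) ∷ fp v

    fq : List (Subset N) → List (Subset N)
    fq [] = []
    fq (x ∷ v) = ((x ∪ sp' (fp v)) ∩ Iq) ∷ fq v

  s : List (Subset N) → Subset N
  s [] = sp' [] ∪ sq' []
  s (x ∷ v) = (sp' (fp v) ∪ sq' (fq v)) ∪ x

  envR : Trace N → ℕ → List (Subset N)
  envR i zero = []
  envR i (suc k) = i k ∷ envR i k

  InTraces : Trace N → Set
  InTraces π = Σ (Trace N) λ i → TraceOver Oe i × (∀ k → π k ≡ s (envR i k))

data LTL (N : ℕ) : Set where
  tt   : LTL N
  atom : Fin N → LTL N
  ¬ₗ_  : LTL N → LTL N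
  _∧ₗ_ : LTL N → LTL N → LTL N
  X_   : LTL N → LTL N
  _U_  : LTL N → LTL N → LTL N

FormulaOver : {N : ℕ} → Subset N → LTL N → Set
FormulaOver V tt = Unit
FormulaOver V (atom x) = x ∈ V
FormulaOver V (¬ₗ φ) = FormulaOver V φ
FormulaOver V (φ ∧ₗ ψ) = FormulaOver V φ × FormulaOver V ψ
FormulaOver V (X φ) = FormulaOver V φ
FormulaOver V (φ U ψ) = FormulaOver V φ × FormulaOver V ψ

_,_⊨_ : {N : ℕ} → Trace N → ℕ → LTL N → Set
π , i ⊨ tt = Unit
π , i ⊨ atom x = x ∈ π i
π , i ⊨ (¬ₗ φ) = ¬ (π , i ⊨ φ)
π , i ⊨ (φ ∧ₗ ψ) = (π , i ⊨ φ) × (π , i ⊨ ψ)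
π , i ⊨ (X φ) = π , suc i ⊨ φ
π , i ⊨ (φ U ψ) = Σ ℕ λ k → (π , (k Data.Nat.+ i) ⊨ ψ) × (∀ j → j < k → π , (j Data.Nat.+ i) ⊨ φ)
  where import Data.Nat

_⊨_ : {N : ℕ} → Trace N → LTL N → Set
π ⊨ φ = π , 0 ⊨ φ

ViolN : {N : ℕ} → Subset N → ℕ → Trace N → LTL N → Set
ViolN V n π φ = ∀ ρ → TraceOver V ρ → (∀ k → k < n → ρ k ≡ π k) → ¬ (ρ ⊨ φ)

ViolF : {N : ℕ} → Subset N → Trace N → LTL N → Set
ViolF V π φ = Σ ℕ λ n → ViolN V n π φ

module _ {N : ℕ} (A : Arch N) (φ : LTL N) where
  open Arch A

  Λp : Trace N → Trace N → Set
  Λp πe πe' = ∀ πp → TraceOver Op πp → (πe ⊔ πp) ⊨ φ → ViolF (Op ∪ Oe) (πe' ⊔ πp) φ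

  Uniform : Set
  Uniform = ∀ πe πp → TraceOver Oe πe → TraceOver Op πp →
            Σ ℕ λ n → ∀ πe' → TraceOver Oe πe' → Λp πe πe' →
              (πe ⊔ πp) ⊨ φ → ViolN (Op ∪ Oe) n (πe' ⊔ πp) φ

-- A p-output at step k is computed from p's inputs at steps 1 … k-1, and a trace of the
-- implementation is replayed from its environment part.  So t can be taken to be the
-- uniformity bound of Λ_p at the split of the unique trace with environment part π_e.
-- If π and π' had the same p-inputs up to that bound, π' would carry the p-outputs of π
-- up to it; since π' ↓ (O_e ∪ O_p) satisfies φ_p, this contradicts the violation of
-- π' ↓ O_e ⊔ π ↓ O_p within the bound that uniformity forces.
module Submission where

open import Defs
open import Data.Nat using (ℕ; zero; suc; _≤_; _<_; s≤s)
open import Data.Nat.Properties using (≤-refl; m≤n⇒m≤1+n; <⇒≤; <-trans)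
open import Data.Fin.Subset using (Subset; _∈_; _⊆_; _∩_; _∪_; ⊥)
open import Data.Fin.Subset.Properties
  using ( ⊆-antisym; ⊆-trans; ⊆-reflexive; p∩q⊆p; p∩q⊆q; x∈p∩q⁺
        ; ∩-assoc; ∩-comm; ∩-zeroʳ; ∪-comm; ∪-identityˡ; ∪-identityʳ
        ; ∩-distribˡ-∪; ∩-distribʳ-∪ )
open import Data.Product using (Σ; _,_; proj₁; proj₂)
open import Data.List using (List; []; _∷_)
open import Relation.Binary.PropositionalEquality
  using (_≡_; _≗_; refl; sym; trans; cong; cong₂; subst; module ≡-Reasoning)
open import Relation.Nullary using (¬_)

open ≡-Reasoning

module _ {N : ℕ} where

  p⊆q⇒p∩q≡p : {p q : Subset N} → p ⊆ q → p ∩ q ≡ p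
  p⊆q⇒p∩q≡p {p} {q} p⊆q = ⊆-antisym (p∩q⊆p p q) (λ x∈p → x∈p∩q⁺ (x∈p , p⊆q x∈p))

  p⊆q∧q∩r≡⊥⇒p∩r≡⊥ : {p q r : Subset N} → p ⊆ q → q ∩ r ≡ ⊥ → p ∩ r ≡ ⊥
  p⊆q∧q∩r≡⊥⇒p∩r≡⊥ {p} {q} {r} p⊆q q∩r≡⊥ = begin
    p ∩ r        ≡⟨ cong (_∩ r) (sym (p⊆q⇒p∩q≡p p⊆q)) ⟩
    (p ∩ q) ∩ r  ≡⟨ ∩-assoc p q r ⟩
    p ∩ (q ∩ r)  ≡⟨ cong (p ∩_) q∩r≡⊥ ⟩
    p ∩ ⊥        ≡⟨ ∩-zeroʳ p ⟩
    ⊥            ∎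

  ∪₃-∩ : (a b c r : Subset N) → ((a ∪ b) ∪ c) ∩ r ≡ (a ∩ r ∪ b ∩ r) ∪ c ∩ r
  ∪₃-∩ a b c r = trans (∩-distribʳ-∪ r (a ∪ b) c) (cong (_∪ c ∩ r) (∩-distribʳ-∪ r a b))

  ↓-traceOver : (V : Subset N) (π : Trace N) → TraceOver V (π ↓ V)
  ↓-traceOver V π k = p∩q⊆q (π k) V

  ↓-∪ : (π : Trace N) (V W : Subset N) → π ↓ (V ∪ W) ≗ (π ↓ V) ⊔ (π ↓ W)
  ↓-∪ π V W k = ∩-distribˡ-∪ (π k) V W

  ⊨-resp-≗ : {π ρ : Trace N} (φ : LTL N) {i : ℕ} → π ≗ ρ → _,_⊨_ π i φ → _,_⊨_ ρ i φ
  ⊨-resp-≗ tt π≗ρ h = h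
  ⊨-resp-≗ (atom x) {i} π≗ρ h = subst (x ∈_) (π≗ρ i) h
  ⊨-resp-≗ (¬ₗ φ) π≗ρ h ρ⊨φ = h (⊨-resp-≗ φ (λ k → sym (π≗ρ k)) ρ⊨φ)
  ⊨-resp-≗ (φ ∧ₗ ψ) π≗ρ (π⊨φ , π⊨ψ) = ⊨-resp-≗ φ π≗ρ π⊨φ , ⊨-resp-≗ ψ π≗ρ π⊨ψ
  ⊨-resp-≗ (X φ) π≗ρ h = ⊨-resp-≗ φ π≗ρ h
  ⊨-resp-≗ (φ U ψ) π≗ρ (k , ψ-at-k , φ-before-k) =
    k , ⊨-resp-≗ ψ π≗ρ ψ-at-k , λ j j<k → ⊨-resp-≗ φ π≗ρ (φ-before-k j j<k)

module Partition {N : ℕ} (A : Arch N) where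
  open Arch A

  Oq∩Op≡⊥ : Oq ∩ Op ≡ ⊥
  Oq∩Op≡⊥ = trans (∩-comm Oq Op) pq-disj

  Oe∩Op≡⊥ : Oe ∩ Op ≡ ⊥
  Oe∩Op≡⊥ = trans (∩-comm Oe Op) pe-disj

  Op∩Ip≡⊥ : Op ∩ Ip ≡ ⊥
  Op∩Ip≡⊥ = trans (∩-comm Op Ip) (p⊆q∧q∩r≡⊥⇒p∩r≡⊥ Ip-sub Oq∪Oe∩Op≡⊥)
    where
    Oq∪Oe∩Op≡⊥ : (Oq ∪ Oe) ∩ Op ≡ ⊥
    Oq∪Oe∩Op≡⊥ = begin
      (Oq ∪ Oe) ∩ Op       ≡⟨ ∩-distribʳ-∪ Op Oq Oe ⟩
      Oq ∩ Op ∪ Oe ∩ Op    ≡⟨ cong₂ _∪_ Oq∩Op≡⊥ Oe∩Op≡⊥ ⟩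
      ⊥ ∪ ⊥                ≡⟨ ∪-identityˡ ⊥ ⟩
      ⊥                    ∎

  module _ {a b : Subset N} (a⊆Op : a ⊆ Op) (b⊆Oq : b ⊆ Oq) where

    outputs-∩Op : (a ∪ b) ∩ Op ≡ a
    outputs-∩Op = begin
      (a ∪ b) ∩ Op         ≡⟨ ∩-distribʳ-∪ Op a b ⟩
      a ∩ Op ∪ b ∩ Op      ≡⟨ cong₂ _∪_ (p⊆q⇒p∩q≡p a⊆Op) (p⊆q∧q∩r≡⊥⇒p∩r≡⊥ b⊆Oq Oq∩Op≡⊥) ⟩
      a ∪ ⊥                ≡⟨ ∪-identityʳ a ⟩
      a                    ∎

    module _ {x : Subset N} (x⊆Oe : x ⊆ Oe) where

      step-∩Oe : ((a ∪ b) ∪ x) ∩ Oe ≡ x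
      step-∩Oe = begin
        ((a ∪ b) ∪ x) ∩ Oe             ≡⟨ ∪₃-∩ a b x Oe ⟩
        (a ∩ Oe ∪ b ∩ Oe) ∪ x ∩ Oe     ≡⟨ cong₂ _∪_ (cong₂ _∪_ (p⊆q∧q∩r≡⊥⇒p∩r≡⊥ a⊆Op pe-disj)
                                                               (p⊆q∧q∩r≡⊥⇒p∩r≡⊥ b⊆Oq qe-disj))
                                                     (p⊆q⇒p∩q≡p x⊆Oe) ⟩
        (⊥ ∪ ⊥) ∪ x                    ≡⟨ cong (_∪ x) (∪-identityˡ ⊥) ⟩
        ⊥ ∪ x                          ≡⟨ ∪-identityˡ x ⟩
        x                              ∎

      step-∩Op : ((a ∪ b) ∪ x) ∩ Op ≡ a
      step-∩Op = begin
        ((a ∪ b) ∪ x) ∩ Op             ≡⟨ ∩-distribʳ-∪ Op (a ∪ b) x ⟩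
        (a ∪ b) ∩ Op ∪ x ∩ Op          ≡⟨ cong₂ _∪_ outputs-∩Op (p⊆q∧q∩r≡⊥⇒p∩r≡⊥ x⊆Oe Oe∩Op≡⊥) ⟩
        a ∪ ⊥                          ≡⟨ ∪-identityʳ a ⟩
        a                              ∎

  step-∩Ip : {a : Subset N} (b x : Subset N) → a ⊆ Op → ((a ∪ b) ∪ x) ∩ Ip ≡ (x ∪ b) ∩ Ip
  step-∩Ip {a} b x a⊆Op = begin
    ((a ∪ b) ∪ x) ∩ Ip             ≡⟨ ∪₃-∩ a b x Ip ⟩
    (a ∩ Ip ∪ b ∩ Ip) ∪ x ∩ Ip     ≡⟨ cong (λ z → (z ∪ b ∩ Ip) ∪ x ∩ Ip) (p⊆q∧q∩r≡⊥⇒p∩r≡⊥ a⊆Op Op∩Ip≡⊥) ⟩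
    (⊥ ∪ b ∩ Ip) ∪ x ∩ Ip          ≡⟨ cong (_∪ x ∩ Ip) (∪-identityˡ (b ∩ Ip)) ⟩
    b ∩ Ip ∪ x ∩ Ip                ≡⟨ ∪-comm (b ∩ Ip) (x ∩ Ip) ⟩
    x ∩ Ip ∪ b ∩ Ip                ≡⟨ ∩-distribʳ-∪ Ip x b ⟨
    (x ∪ b) ∩ Ip                   ∎

module Implementation {N : ℕ} (A : Arch N) (sp sq : Strategy N) where
  open Arch A
  open Partition A
  open Composition A sp sq

  sp'⊆Op : (w : List (Subset N)) → sp' w ⊆ Op
  sp'⊆Op w = p∩q⊆q _ Op

  sq'⊆Oq : (w : List (Subset N)) → sq' w ⊆ Oq
  sq'⊆Oq w = p∩q⊆q _ Oq

  run : Trace N → Trace N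
  run i k = s (envR i k)

  -- The composition reads no environment input at step 0, so the input at step j sits at step j+1.
  replay : Trace N → Trace N
  replay πe = run (λ j → πe (suc j))

  envR-cong : {i i' : Trace N} → i ≗ i' → ∀ k → envR i k ≡ envR i' k
  envR-cong i≗i' zero = refl
  envR-cong i≗i' (suc k) = cong₂ _∷_ (i≗i' k) (envR-cong i≗i' k)

  replay-↓Oe : {π : Trace N} → InTraces π → replay (π ↓ Oe) ≗ π
  replay-↓Oe {π} (i , i-over , π≗run) k =
    trans (cong s (envR-cong env-recovered k)) (sym (π≗run k))
    where
    env-recovered : (λ j → π (suc j) ∩ Oe) ≗ i
    env-recovered j =
      trans (cong (_∩ Oe) (π≗run (suc j)))
            (step-∩Oe (sp'⊆Op (fp (envR i j))) (sq'⊆Oq (fq (envR i j))) (i-over j))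

  inputHistory : Trace N → ℕ → List (Subset N)
  inputHistory π zero = []
  inputHistory π (suc k) = (π (suc k) ∩ Ip) ∷ inputHistory π k

  fp-envR : {π i : Trace N} → π ≗ run i → ∀ k → fp (envR i k) ≡ inputHistory π k
  fp-envR π≗run zero = refl
  fp-envR {π} {i} π≗run (suc k) = cong₂ _∷_ input-at-suc-k (fp-envR π≗run k)
    where
    input-at-suc-k : (i k ∪ sq' (fq (envR i k))) ∩ Ip ≡ π (suc k) ∩ Ip
    input-at-suc-k =
      sym (trans (cong (_∩ Ip) (π≗run (suc k))) (step-∩Ip _ (i k) (sp'⊆Op (fp (envR i k)))))

  inputHistory-cong : {π π' : Trace N} (k : ℕ) →
    (∀ j → j ≤ k → π j ∩ Ip ≡ π' j ∩ Ip) → inputHistory π k ≡ inputHistory π' k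
  inputHistory-cong zero agree = refl
  inputHistory-cong (suc k) agree =
    cong₂ _∷_ (agree (suc k) ≤-refl) (inputHistory-cong k (λ j j≤k → agree j (m≤n⇒m≤1+n j≤k)))

  ∩Op-initial : {π : Trace N} → InTraces π → π 0 ∩ Op ≡ sp' []
  ∩Op-initial (_ , _ , π≗run) = trans (cong (_∩ Op) (π≗run 0)) (outputs-∩Op (sp'⊆Op []) (sq'⊆Oq []))

  ∩Op-inputHistory : {π : Trace N} → InTraces π → ∀ k → π (suc k) ∩ Op ≡ sp' (inputHistory π k)
  ∩Op-inputHistory {π} (i , i-over , π≗run) k = begin
    π (suc k) ∩ Op                ≡⟨ cong (_∩ Op) (π≗run (suc k)) ⟩
    s (i k ∷ envR i k) ∩ Op       ≡⟨ step-∩Op (sp'⊆Op (fp (envR i k))) (sq'⊆Oq (fq (envR i k))) (i-over k) ⟩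
    sp' (fp (envR i k))           ≡⟨ cong sp' (fp-envR π≗run k) ⟩
    sp' (inputHistory π k)        ∎

  outputs-determined-by-inputs : {π π' : Trace N} → InTraces π → InTraces π' → ∀ k →
    (∀ j → j < k → π j ∩ Ip ≡ π' j ∩ Ip) → π k ∩ Op ≡ π' k ∩ Op
  outputs-determined-by-inputs π∈ π'∈ zero _ = trans (∩Op-initial π∈) (sym (∩Op-initial π'∈))
  outputs-determined-by-inputs {π} {π'} π∈ π'∈ (suc k) agree = begin
    π (suc k) ∩ Op                ≡⟨ ∩Op-inputHistory π∈ k ⟩
    sp' (inputHistory π k)        ≡⟨ cong sp' (inputHistory-cong k (λ j j≤k → agree j (s≤s j≤k))) ⟩
    sp' (inputHistory π' k)       ≡⟨ ∩Op-inputHistory π'∈ k ⟨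
    π' (suc k) ∩ Op               ∎

module Distinguishability {N : ℕ} (A : Arch N) (φ : LTL N) where
  open Arch A

  Λp-respˡ : {πe πe₀ πe' : Trace N} → πe ≗ πe₀ → Λp A φ πe₀ πe' → Λp A φ πe πe'
  Λp-respˡ πe≗πe₀ Λ πp πp-over h = Λ πp πp-over (⊨-resp-≗ φ (λ k → cong (_∪ πp k) (πe≗πe₀ k)) h)

  p-outputs-differ-within-bound : Uniform A φ → (ρ : Trace N) → Σ ℕ λ n → ∀ ρ' →
    Λp A φ (ρ ↓ Oe) (ρ' ↓ Oe) → (ρ ↓ (Oe ∪ Op)) ⊨ φ → (ρ' ↓ (Oe ∪ Op)) ⊨ φ →
    ¬ (∀ k → k < n → ρ' k ∩ Op ≡ ρ k ∩ Op)
  p-outputs-differ-within-bound uniform ρ = proj₁ bounded , differ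
    where
    bounded : Σ ℕ λ n → ∀ πe' → TraceOver Oe πe' → Λp A φ (ρ ↓ Oe) πe' →
      ((ρ ↓ Oe) ⊔ (ρ ↓ Op)) ⊨ φ → ViolN (Op ∪ Oe) n (πe' ⊔ (ρ ↓ Op)) φ
    bounded = uniform (ρ ↓ Oe) (ρ ↓ Op) (↓-traceOver Oe ρ) (↓-traceOver Op ρ)

    differ : ∀ ρ' → Λp A φ (ρ ↓ Oe) (ρ' ↓ Oe) → (ρ ↓ (Oe ∪ Op)) ⊨ φ → (ρ' ↓ (Oe ∪ Op)) ⊨ φ →
      ¬ (∀ k → k < proj₁ bounded → ρ' k ∩ Op ≡ ρ k ∩ Op)
    differ ρ' Λ ρ⊨φ ρ'⊨φ agree =
      proj₂ bounded (ρ' ↓ Oe) (↓-traceOver Oe ρ') Λ (⊨-resp-≗ φ (↓-∪ ρ Oe Op) ρ⊨φ)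
        (ρ' ↓ (Oe ∪ Op)) over-Op∪Oe agree-before-bound ρ'⊨φ
      where
      over-Op∪Oe : TraceOver (Op ∪ Oe) (ρ' ↓ (Oe ∪ Op))
      over-Op∪Oe k = ⊆-trans (p∩q⊆q (ρ' k) (Oe ∪ Op)) (⊆-reflexive (∪-comm Oe Op))

      agree-before-bound : ∀ k → k < proj₁ bounded → (ρ' ↓ (Oe ∪ Op)) k ≡ ((ρ' ↓ Oe) ⊔ (ρ ↓ Op)) k
      agree-before-bound k k<n = trans (↓-∪ ρ' Oe Op k) (cong (ρ' k ∩ Oe ∪_) (agree k k<n))

theorem2 : {N : ℕ} (A : Arch N) (sp sq : Strategy N) (φ : LTL N) →
    FormulaOver (Arch.Op A ∪ Arch.Oe A) φ →
    Uniform A φ →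
    (∀ π → Composition.InTraces A sp sq π → (π ↓ (Arch.Oe A ∪ Arch.Op A)) ⊨ φ) →
    Σ (Trace N → ℕ) λ t →
      ∀ π π' → Composition.InTraces A sp sq π → Composition.InTraces A sp sq π' →
        Λp A φ (π ↓ Arch.Oe A) (π' ↓ Arch.Oe A) →
        ¬ (∀ k → k ≤ t (π ↓ Arch.Oe A) → (π k ∩ Arch.Ip A) ≡ (π' k ∩ Arch.Ip A))
theorem2 {N} A sp sq φ _ uniform correct = t , distinguishes
  where
  open Arch A
  open Composition A sp sq using (InTraces)
  open Implementation A sp sq
  open Distinguishability A φ

  t : Trace N → ℕ
  t πe = proj₁ (p-outputs-differ-within-bound uniform (replay πe))

  distinguishes : ∀ π π' → InTraces π → InTraces π' → Λp A φ (π ↓ Oe) (π' ↓ Oe) →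
    ¬ (∀ k → k ≤ t (π ↓ Oe) → π k ∩ Ip ≡ π' k ∩ Ip)
  distinguishes π π' π∈ π'∈ Λ inputs-agree =
    proj₂ (p-outputs-differ-within-bound uniform (replay (π ↓ Oe))) π'
      (Λp-respˡ (λ k → cong (_∩ Oe) (replay≗π k)) Λ)
      (⊨-resp-≗ φ (λ k → cong (_∩ (Oe ∪ Op)) (sym (replay≗π k))) (correct π π∈))
      (correct π' π'∈)
      outputs-agree
    where
    replay≗π : replay (π ↓ Oe) ≗ π
    replay≗π = replay-↓Oe π∈

    outputs-agree : ∀ k → k < t (π ↓ Oe) → π' k ∩ Op ≡ replay (π ↓ Oe) k ∩ Op
    outputs-agree k k<n = trans
      (outputs-determined-by-inputs π'∈ π∈ k (λ j j<k → sym (inputs-agree j (<⇒≤ (<-trans j<k k<n)))))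
      (cong (_∩ Op) (sym (replay≗π k)))
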